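{- For every positive integer $d$, $\lambda\big((\mathsf{AND}_2\circ\mathsf{OR}_2)^d\big)=2^d$.
   Context: $\mathsf{AND}_2\circ\mathsf{OR}_2(x_1,x_2,x_3,x_4)=(x_1\vee x_2)\wedge(x_3\vee x_4)$, and $(\mathsf{AND}_2\circ\mathsf{OR}_2)^d$ is this function composed with itself $d$ times, where $F\circ G(x_1,\dots,x_a)=F(G(x_1),\dots,G(x_a))$. For $f\colon\{0,1\}^n\to\{0,1\}$, the sensitivity graph $G_f$ has vertex set $\{0,1\}^n$ and an edge between $x$ and $x\oplus e_i$ whenever $f(x)\neq f(x\oplus e_i)$; with adjacency matrix $A_f$, the spectral sensitivity is $\lambda(f)=\|A_f\|$ (spectral norm).
   Formalization: In the spectral norm $\|A_f\|$, the test vectors indexed by $\{0,1\}^n$ have rational entries rather than real ones. -}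

module Defs where

open import Data.Bool using (Bool; true; false; _∧_; _∨_; _xor_; not; if_then_else_)
open import Data.Nat as ℕ using (ℕ; zero; suc; _^_)
open import Data.Fin using (Fin)
open import Data.Vec using (Vec; []; _∷_; head; take; drop; map)
open import Data.List using (List; []; _∷_; _++_; foldr)
import Data.List as List
open import Data.Integer using (+_)
open import Data.Rational using (ℚ; 0ℚ; 1ℚ; _+_; _*_; _≤_; _/_)
open import Data.Product using (_×_; Σ)
open import Relation.Binary.PropositionalEquality using (_≡_)
open import Relation.Nullary using (¬_)

BoolFun : ℕ → Set
BoolFun n = Vec Bool n → Bool

AND2∘OR2 : BoolFun 4
AND2∘OR2 (x₁ ∷ x₂ ∷ x₃ ∷ x₄ ∷ []) = (x₁ ∨ x₂) ∧ (x₃ ∨ x₄)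

chunks : ∀ {A : Set} a b → Vec A (a ℕ.* b) → Vec (Vec A b) a
chunks zero    b []  = []
chunks (suc a) b xs  = take b xs ∷ chunks a b (drop b xs)

_⊚_ : ∀ {a b} → BoolFun a → BoolFun b → BoolFun (a ℕ.* b)
_⊚_ {a} {b} F G x = F (map G (chunks a b x))

-- f ^ d : f composed with itself d times (f ^ 0 = identity on one bit)
_^^_ : ∀ {k} → BoolFun k → (d : ℕ) → BoolFun (k ^ d)
f ^^ zero  = head
f ^^ suc d = f ⊚ (f ^^ d)

cube : (n : ℕ) → List (Vec Bool n)
cube zero    = [] ∷ []
cube (suc n) = List.map (false ∷_) (cube n) ++ List.map (true ∷_) (cube n)

hamming : ∀ {n} → Vec Bool n → Vec Bool n → ℕ
hamming []       []       = 0
hamming (x ∷ xs) (y ∷ ys) = (if x xor y then 1 else 0) ℕ.+ hamming xs ys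

isOne : ℕ → Bool
isOne 1 = true
isOne _ = false

-- adjacency matrix of the sensitivity graph G_f:
-- A_f(x,y) = 1 iff y = x ⊕ e_i for some i and f(x) ≠ f(y)
adj : ∀ {n} → BoolFun n → Vec Bool n → Vec Bool n → ℚ
adj f x y = if isOne (hamming x y) ∧ (f x xor f y) then 1ℚ else 0ℚ

RVec : ℕ → Set
RVec n = Vec Bool n → ℚ

Σcube : ∀ n → (Vec Bool n → ℚ) → ℚ
Σcube n g = foldr (λ v acc → g v + acc) 0ℚ (cube n)

_·ᵥ_ : ∀ {n} → (Vec Bool n → Vec Bool n → ℚ) → RVec n → RVec n
_·ᵥ_ {n} M v x = Σcube n (λ y → M x y * v y)

‖_‖² : ∀ {n} → RVec n → ℚ
‖_‖² {n} v = Σcube n (λ x → v x * v x)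

-- ‖M‖ = c  (spectral norm = max_{v ≠ 0} ‖Mv‖/‖v‖, stated with squares;
-- vectors range over ℚ^{2^n})
SpectralNormIs : ∀ {n} → (Vec Bool n → Vec Bool n → ℚ) → ℚ → Set
SpectralNormIs {n} M c =
  (∀ (v : RVec n) → ‖ M ·ᵥ v ‖² ≤ (c * c) * ‖ v ‖²) ×
  Σ (RVec n) (λ v → ¬ (‖ v ‖² ≡ 0ℚ) × (‖ M ·ᵥ v ‖² ≡ (c * c) * ‖ v ‖²))

spectralSensitivityIs : ∀ {n} → BoolFun n → ℚ → Set
spectralSensitivityIs f c = SpectralNormIs (adj f) c

ℕ→ℚ : ℕ → ℚ
ℕ→ℚ m = (+ m) / 1

{-# OPTIONS --safe #-}

-- The adjacency matrix A_f is symmetric and nonnegative, and its row sum at x is the sensitivity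
-- s(f, x). Cauchy–Schwarz (the Schur test) therefore gives ‖A_f v‖ ≤ D ‖v‖ when s(f, ·) ≤ D
-- everywhere; and if a nonempty set of inputs is closed under the edges of G_f and s(f, x) = D on
-- all of it, its indicator vector is an eigenvector of A_f with eigenvalue D. Together, λ(f) = D.
--
-- For a composition, s(F ∘ G, x) is the sum of s(G, xᵢ) over the blocks i at which F is sensitive
-- at (G(x₁), …, G(xₐ)). As AND₂∘OR₂ has sensitivity at most 2, (AND₂∘OR₂)^d has sensitivity at
-- most 2^d. The inputs of AND₂∘OR₂ in which each OR gate sees at most one true bit, and some bit
-- is true, have sensitivity exactly 2 and are closed under sensitive flips; asking this of every
-- gate of (AND₂∘OR₂)^d gives a nonempty closed set of inputs of sensitivity exactly 2^d.

module Submission where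

open import Defs
open import Data.Bool using (Bool; true; false; not; _∧_; _∨_; _xor_; if_then_else_)
import Data.Bool.Properties as Bool
open import Data.Bool.Properties using (xor-same; xor-comm; ¬-not; ∧-assoc; ∧-conicalˡ; ∧-conicalʳ)
import Data.List as List
open import Data.List.Membership.Propositional using (_∈_)
open import Data.List.Membership.Propositional.Properties using (∈-map⁺; ∈-++⁺ˡ; ∈-++⁺ʳ)
open import Data.List.Relation.Unary.All as All using (All)
open import Data.List.Relation.Unary.Any using (here; there)
open import Data.Nat as ℕ using (ℕ; zero; suc; _^_; z≤n; s≤s)
import Data.Nat.Properties as ℕ
open import Data.Product using (Σ; ∃; _×_; _,_; proj₁; proj₂)
open import Data.Sum using (_⊎_; inj₁; inj₂)
open import Data.Vec using (Vec; []; _∷_; _++_; map; concat; splitAt)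
import Data.Vec.Properties as Vec
open import Function using (_∘_)
open import Relation.Binary.PropositionalEquality
open import Relation.Nullary using (Dec; ¬?)
open import Relation.Nullary.Decidable using (True; toWitness; _→-dec_)

∈-cube : ∀ {n} (x : Vec Bool n) → x ∈ cube n
∈-cube []          = here refl
∈-cube (false ∷ x) = ∈-++⁺ˡ (∈-map⁺ (false ∷_) (∈-cube x))
∈-cube (true ∷ x)  = ∈-++⁺ʳ (List.map (false ∷_) (cube _)) (∈-map⁺ (true ∷_) (∈-cube x))

cube-exhaustive : ∀ {n} {P : Vec Bool n → Set} → All P (cube n) → ∀ x → P x
cube-exhaustive ps x = All.lookup ps (∈-cube x)

bit : Bool → ℕ
bit b = if b then 1 else 0

sensitivity : ∀ {n} → BoolFun n → Vec Bool n → ℕ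
sensitivity f []      = 0
sensitivity f (b ∷ x) = bit (f (b ∷ x) xor f (not b ∷ x)) ℕ.+ sensitivity (λ y → f (b ∷ y)) x

data Flip : ∀ {n} → Vec Bool n → Vec Bool n → Set where
  here  : ∀ {n b} {x : Vec Bool n} → Flip (b ∷ x) (not b ∷ x)
  there : ∀ {n b} {x y : Vec Bool n} → Flip x y → Flip (b ∷ x) (b ∷ y)

hamming-self : ∀ {n} (x : Vec Bool n) → hamming x x ≡ 0
hamming-self []          = refl
hamming-self (false ∷ x) = hamming-self x
hamming-self (true ∷ x)  = hamming-self x

hamming-sym : ∀ {n} (x y : Vec Bool n) → hamming x y ≡ hamming y x
hamming-sym []      []      = refl
hamming-sym (a ∷ x) (b ∷ y) = cong₂ (λ c h → bit c ℕ.+ h) (xor-comm a b) (hamming-sym x y)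

hamming≡0⇒≡ : ∀ {n} {x y : Vec Bool n} → hamming x y ≡ 0 → x ≡ y
hamming≡0⇒≡ {x = []}        {[]}        _ = refl
hamming≡0⇒≡ {x = false ∷ x} {false ∷ y} h = cong (false ∷_) (hamming≡0⇒≡ h)
hamming≡0⇒≡ {x = true ∷ x}  {true ∷ y}  h = cong (true ∷_) (hamming≡0⇒≡ h)

hamming≡1⇒Flip : ∀ {n} {x y : Vec Bool n} → hamming x y ≡ 1 → Flip x y
hamming≡1⇒Flip {x = []}        {[]}        ()
hamming≡1⇒Flip {x = false ∷ x} {false ∷ y} h = there (hamming≡1⇒Flip h)
hamming≡1⇒Flip {x = true ∷ x}  {true ∷ y}  h = there (hamming≡1⇒Flip h)
hamming≡1⇒Flip {x = false ∷ x} {true ∷ y}  h =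
  subst (λ z → Flip (false ∷ x) (true ∷ z)) (hamming≡0⇒≡ (ℕ.suc-injective h)) here
hamming≡1⇒Flip {x = true ∷ x}  {false ∷ y} h =
  subst (λ z → Flip (true ∷ x) (false ∷ z)) (hamming≡0⇒≡ (ℕ.suc-injective h)) here

Flip⇒hamming≡1 : ∀ {n} {x y : Vec Bool n} → Flip x y → hamming x y ≡ 1
Flip⇒hamming≡1 (here {b = false} {x})  = cong suc (hamming-self x)
Flip⇒hamming≡1 (here {b = true} {x})   = cong suc (hamming-self x)
Flip⇒hamming≡1 (there {b = false} x~y) = Flip⇒hamming≡1 x~y
Flip⇒hamming≡1 (there {b = true} x~y)  = Flip⇒hamming≡1 x~y

isOne⇒≡1 : ∀ {m} → isOne m ≡ true → m ≡ 1
isOne⇒≡1 {1} _ = refl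

xor≡true⇒≢ : ∀ {p q} → p xor q ≡ true → p ≢ q
xor≡true⇒≢ {false} {true}  _ ()
xor≡true⇒≢ {true}  {false} _ ()

Closed : ∀ {n} → BoolFun n → (Vec Bool n → Bool) → Set
Closed {n} f P = ∀ {x y : Vec Bool n} → Flip x y → f x ≢ f y → P x ≡ P y

-- A separate module keeps the rational _≤_ apart from the natural one used after it.
module SpectralNorm where

  import Data.Integer as ℤ
  import Data.Integer.Properties as ℤ
  open import Data.List using (List; []; _∷_; foldr)
  open import Data.Nat.Coprimality using (1-coprimeTo)
  import Data.Nat.Coprimality as Coprime
  open import Data.Rational using (ℚ; 0ℚ; 1ℚ; _+_; _*_; _-_; _≤_; nonNegative; nonPositive)
  import Data.Rational.Properties as ℚ
  open import Data.Rational.Solver using (module +-*-Solver)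

  ∑ : ∀ {A : Set} → List A → (A → ℚ) → ℚ
  ∑ L g = foldr (λ v acc → g v + acc) 0ℚ L

  module _ {A : Set} where

    ∑-cong : ∀ (L : List A) {g h : A → ℚ} → (∀ x → g x ≡ h x) → ∑ L g ≡ ∑ L h
    ∑-cong []      g≡h = refl
    ∑-cong (x ∷ L) g≡h = cong₂ _+_ (g≡h x) (∑-cong L g≡h)

    ∑-zero : ∀ (L : List A) → ∑ L (λ _ → 0ℚ) ≡ 0ℚ
    ∑-zero []      = refl
    ∑-zero (x ∷ L) = trans (ℚ.+-identityˡ _) (∑-zero L)

    ∑-+ : ∀ (L : List A) (g h : A → ℚ) → ∑ L (λ x → g x + h x) ≡ ∑ L g + ∑ L h
    ∑-+ []      g h = refl
    ∑-+ (x ∷ L) g h = trans (cong (g x + h x +_) (∑-+ L g h)) (interchange (g x) (h x) (∑ L g) (∑ L h))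
      where
      open +-*-Solver
      interchange : ∀ p q r s → p + q + (r + s) ≡ p + r + (q + s)
      interchange = solve 4 (λ p q r s → p :+ q :+ (r :+ s) := p :+ r :+ (q :+ s)) refl

    ∑-*ˡ : ∀ (L : List A) (c : ℚ) (g : A → ℚ) → ∑ L (λ x → c * g x) ≡ c * ∑ L g
    ∑-*ˡ []      c g = sym (ℚ.*-zeroʳ c)
    ∑-*ˡ (x ∷ L) c g = trans (cong (c * g x +_) (∑-*ˡ L c g)) (sym (ℚ.*-distribˡ-+ c (g x) (∑ L g)))

    ∑-*ʳ : ∀ (L : List A) (c : ℚ) (g : A → ℚ) → ∑ L (λ x → g x * c) ≡ ∑ L g * c
    ∑-*ʳ L c g = trans (∑-cong L (λ x → ℚ.*-comm (g x) c)) (trans (∑-*ˡ L c g) (ℚ.*-comm c (∑ L g)))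

    ∑-mono-≤ : ∀ (L : List A) {g h : A → ℚ} → (∀ x → g x ≤ h x) → ∑ L g ≤ ∑ L h
    ∑-mono-≤ []      g≤h = ℚ.≤-refl
    ∑-mono-≤ (x ∷ L) g≤h = ℚ.+-mono-≤ (g≤h x) (∑-mono-≤ L g≤h)

    ∑-nonNeg : ∀ (L : List A) {g : A → ℚ} → (∀ x → 0ℚ ≤ g x) → 0ℚ ≤ ∑ L g
    ∑-nonNeg L {g} 0≤g = subst (_≤ ∑ L g) (∑-zero L) (∑-mono-≤ L 0≤g)

    ∑-≥-term : ∀ {L : List A} {g : A → ℚ} → (∀ x → 0ℚ ≤ g x) → ∀ {x} → x ∈ L → g x ≤ ∑ L g
    ∑-≥-term {y ∷ L} {g} 0≤g (here refl) =
      subst (_≤ g y + ∑ L g) (ℚ.+-identityʳ (g y)) (ℚ.+-monoʳ-≤ (g y) (∑-nonNeg L 0≤g))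
    ∑-≥-term {y ∷ L} {g} 0≤g (there x∈L) =
      subst (_≤ g y + ∑ L g) (ℚ.+-identityˡ _) (ℚ.+-mono-≤ (0≤g y) (∑-≥-term 0≤g x∈L))

    ∑-++ : ∀ (L K : List A) (g : A → ℚ) → ∑ (L List.++ K) g ≡ ∑ L g + ∑ K g
    ∑-++ []      K g = sym (ℚ.+-identityˡ _)
    ∑-++ (x ∷ L) K g = trans (cong (g x +_) (∑-++ L K g)) (sym (ℚ.+-assoc (g x) _ _))

  ∑-map : ∀ {A B : Set} (f : A → B) (L : List A) (g : B → ℚ) → ∑ (List.map f L) g ≡ ∑ L (λ x → g (f x))
  ∑-map f []      g = refl
  ∑-map f (x ∷ L) g = cong (g (f x) +_) (∑-map f L g)

  ∑-swap : ∀ {A B : Set} (L : List A) (K : List B) (g : A → B → ℚ) →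
           ∑ L (λ x → ∑ K (g x)) ≡ ∑ K (λ y → ∑ L (λ x → g x y))
  ∑-swap []      K g = sym (∑-zero K)
  ∑-swap (x ∷ L) K g = trans (cong (∑ K (g x) +_) (∑-swap L K g)) (sym (∑-+ K (g x) _))

  ∑-*-∑ : ∀ {A B : Set} (L : List A) (K : List B) (g : A → ℚ) (h : B → ℚ) →
          ∑ L g * ∑ K h ≡ ∑ L (λ x → ∑ K (λ y → g x * h y))
  ∑-*-∑ L K g h = trans (sym (∑-*ʳ L (∑ K h) g)) (∑-cong L (λ x → sym (∑-*ˡ K (g x) h)))

  Σcube-split : ∀ {n} b (g : Vec Bool (suc n) → ℚ) →
                Σcube (suc n) g ≡ Σcube n (λ y → g (b ∷ y)) + Σcube n (λ y → g (not b ∷ y))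
  Σcube-split {n} false g = trans (∑-++ (List.map (false ∷_) (cube n)) _ g)
    (cong₂ _+_ (∑-map (false ∷_) (cube n) g) (∑-map (true ∷_) (cube n) g))
  Σcube-split {n} true g = trans (Σcube-split false g) (ℚ.+-comm (Σcube n (λ y → g (false ∷ y))) _)

  ℕ→ℚ-suc : ∀ m → ℕ→ℚ (suc m) ≡ 1ℚ + ℕ→ℚ m
  ℕ→ℚ-suc m = trans (ℚ./-cong (cong (ℤ._+_ (ℤ.+ 1)) (sym (ℤ.*-identityʳ (ℤ.+ m)))) refl)
                    (cong (1ℚ +_) (sym (ℚ.normalize-coprime (Coprime.sym (1-coprimeTo m)))))

  ℕ→ℚ-nonNeg : ∀ m → 0ℚ ≤ ℕ→ℚ m
  ℕ→ℚ-nonNeg m = ℚ.nonNegative⁻¹ (ℕ→ℚ m) {{ℚ.normalize-nonNeg m 1}}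

  ℕ→ℚ-mono-≤ : ∀ {m n} → m ℕ.≤ n → ℕ→ℚ m ≤ ℕ→ℚ n
  ℕ→ℚ-mono-≤ {n = n} z≤n = ℕ→ℚ-nonNeg n
  ℕ→ℚ-mono-≤ {suc m} {suc n} (s≤s m≤n) =
    subst₂ _≤_ (sym (ℕ→ℚ-suc m)) (sym (ℕ→ℚ-suc n)) (ℚ.+-monoʳ-≤ 1ℚ (ℕ→ℚ-mono-≤ m≤n))

  *-nonNeg : ∀ {p q} → 0ℚ ≤ p → 0ℚ ≤ q → 0ℚ ≤ p * q
  *-nonNeg {p} {q} 0≤p 0≤q =
    ℚ.nonNegative⁻¹ (p * q) {{ℚ.nonNeg*nonNeg⇒nonNeg p {{nonNegative 0≤p}} q {{nonNegative 0≤q}}}}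

  square-nonNeg : ∀ p → 0ℚ ≤ p * p
  square-nonNeg p with ℚ.≤-total 0ℚ p
  ... | inj₁ 0≤p = *-nonNeg 0≤p 0≤p
  ... | inj₂ p≤0 = subst (_≤ p * p) (ℚ.*-zeroʳ p) (ℚ.*-monoˡ-≤-nonPos p {{nonPositive p≤0}} p≤0)

  p*q+p*q≤p*p+q*q : ∀ p q → p * q + p * q ≤ p * p + q * q
  p*q+p*q≤p*p+q*q p q = subst (p * q + p * q ≤_) (completeSquare p q)
    (subst (_≤ (p - q) * (p - q) + (p * q + p * q)) (ℚ.+-identityˡ _)
      (ℚ.+-monoˡ-≤ (p * q + p * q) (square-nonNeg (p - q))))
    where
    open +-*-Solver
    completeSquare : ∀ p q → (p - q) * (p - q) + (p * q + p * q) ≡ p * p + q * q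
    completeSquare = solve 2 (λ p q → (p :- q) :* (p :- q) :+ (p :* q :+ p :* q) := p :* p :+ q :* q) refl

  double-cancel-≤ : ∀ {p q} → p + p ≤ q + q → p ≤ q
  double-cancel-≤ {p} {q} 2p≤2q = ℚ.*-cancelˡ-≤-pos (1ℚ + 1ℚ) (subst₂ _≤_ (double p) (double q) 2p≤2q)
    where
    open +-*-Solver
    double : ∀ p → p + p ≡ (1ℚ + 1ℚ) * p
    double = solve 1 (λ p → p :+ p := (con 1ℚ :+ con 1ℚ) :* p) refl

  -- Summing the termwise AM-GM bound 2 a_y a_z v_y v_z ≤ a_y a_z (v_y² + v_z²) over all pairs (y, z).
  ∑-cauchy-schwarz : ∀ {A : Set} (L : List A) (a v : A → ℚ) → (∀ y → 0ℚ ≤ a y) →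
    ∑ L (λ y → a y * v y) * ∑ L (λ y → a y * v y) ≤ ∑ L a * ∑ L (λ y → a y * (v y * v y))
  ∑-cauchy-schwarz L a v 0≤a = double-cancel-≤ (begin
      S * S + S * S
    ≡⟨ cong₂ _+_ S*S S*S ⟩
      ∑² T + ∑² T
    ≡⟨ ∑²-+ T T ⟨
      ∑² (λ y z → T y z + T y z)
    ≤⟨ ∑-mono-≤ L (λ y → ∑-mono-≤ L (λ z → pair-bound y z)) ⟩
      ∑² (λ y z → U y z + U′ y z)
    ≡⟨ ∑²-+ U U′ ⟩
      ∑² U + ∑² U′
    ≡⟨ cong₂ _+_ (∑-*-∑ L L av² a) (∑-*-∑ L L a av²) ⟨
      R * W + W * R
    ≡⟨ cong (_+ W * R) (ℚ.*-comm R W) ⟩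
      W * R + W * R ∎)
    where
    open ℚ.≤-Reasoning
    open +-*-Solver
    av av² : _ → ℚ
    av y = a y * v y
    av² y = a y * (v y * v y)
    S = ∑ L av
    W = ∑ L a
    R = ∑ L av²
    ∑² : (_ → _ → ℚ) → ℚ
    ∑² g = ∑ L (λ y → ∑ L (g y))
    ∑²-+ : ∀ g h → ∑² (λ y z → g y z + h y z) ≡ ∑² g + ∑² h
    ∑²-+ g h = trans (∑-cong L (λ y → ∑-+ L (g y) (h y))) (∑-+ L (λ y → ∑ L (g y)) (λ y → ∑ L (h y)))
    T U U′ : _ → _ → ℚ
    T y z = av y * av z
    U y z = av² y * a z
    U′ y z = a y * av² z
    S*S : S * S ≡ ∑² T
    S*S = ∑-*-∑ L L av av
    pair-bound : ∀ y z → T y z + T y z ≤ U y z + U′ y z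
    pair-bound y z = subst₂ _≤_ (lhs (a y) (a z) (v y) (v z)) (rhs (a y) (a z) (v y) (v z))
      (ℚ.*-monoˡ-≤-nonNeg (a y * a z) {{nonNegative (*-nonNeg (0≤a y) (0≤a z))}} (p*q+p*q≤p*p+q*q (v y) (v z)))
      where
      lhs : ∀ ay az vy vz → ay * az * (vy * vz + vy * vz) ≡ (ay * vy) * (az * vz) + (ay * vy) * (az * vz)
      lhs = solve 4 (λ ay az vy vz → ay :* az :* (vy :* vz :+ vy :* vz)
                                  := (ay :* vy) :* (az :* vz) :+ (ay :* vy) :* (az :* vz)) refl
      rhs : ∀ ay az vy vz → ay * az * (vy * vy + vz * vz) ≡ (ay * (vy * vy)) * az + ay * (az * (vz * vz))
      rhs = solve 4 (λ ay az vy vz → ay :* az :* (vy :* vy :+ vz :* vz)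
                                  := (ay :* (vy :* vy)) :* az :+ ay :* (az :* (vz :* vz))) refl

  𝟙 : Bool → ℚ
  𝟙 b = if b then 1ℚ else 0ℚ

  𝟙-nonNeg : ∀ b → 0ℚ ≤ 𝟙 b
  𝟙-nonNeg true  = ℚ.nonNegative⁻¹ 1ℚ
  𝟙-nonNeg false = ℚ.≤-refl

  ℕ→ℚ-bit-+ : ∀ b m → ℕ→ℚ (bit b ℕ.+ m) ≡ 𝟙 b + ℕ→ℚ m
  ℕ→ℚ-bit-+ true  m = ℕ→ℚ-suc m
  ℕ→ℚ-bit-+ false m = sym (ℚ.+-identityˡ _)

  module _ {n : ℕ} (f : BoolFun n) where

    adj-sym : ∀ x y → adj f x y ≡ adj f y x
    adj-sym x y = cong₂ (λ h e → 𝟙 (isOne h ∧ e)) (hamming-sym x y) (xor-comm (f x) (f y))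

    adj-nonNeg : ∀ x y → 0ℚ ≤ adj f x y
    adj-nonNeg x y = 𝟙-nonNeg (isOne (hamming x y) ∧ (f x xor f y))

  Σcube-𝟙-hamming≡0 : ∀ {n} (x : Vec Bool n) (g : Vec Bool n → Bool) →
                  Σcube n (λ y → 𝟙 (isOne (suc (hamming x y)) ∧ g y)) ≡ 𝟙 (g x)
  Σcube-𝟙-hamming≡0 []          g = ℚ.+-identityʳ _
  Σcube-𝟙-hamming≡0 {suc n} (false ∷ x) g =
    trans (Σcube-split false (λ y → 𝟙 (isOne (suc (hamming (false ∷ x) y)) ∧ g y)))
      (trans (cong₂ _+_ (Σcube-𝟙-hamming≡0 x (λ y → g (false ∷ y))) (∑-zero (cube n))) (ℚ.+-identityʳ _))
  Σcube-𝟙-hamming≡0 {suc n} (true ∷ x)  g =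
    trans (Σcube-split true (λ y → 𝟙 (isOne (suc (hamming (true ∷ x) y)) ∧ g y)))
      (trans (cong₂ _+_ (Σcube-𝟙-hamming≡0 x (λ y → g (true ∷ y))) (∑-zero (cube n))) (ℚ.+-identityʳ _))

  adj-∷-same : ∀ {n} (f : BoolFun (suc n)) b x y → adj f (b ∷ x) (b ∷ y) ≡ adj (λ z → f (b ∷ z)) x y
  adj-∷-same f false x y = refl
  adj-∷-same f true  x y = refl

  adj-∷-not : ∀ {n} (f : BoolFun (suc n)) b x y →
              adj f (b ∷ x) (not b ∷ y) ≡ 𝟙 (isOne (suc (hamming x y)) ∧ (f (b ∷ x) xor f (not b ∷ y)))
  adj-∷-not f false x y = refl
  adj-∷-not f true  x y = refl

  adj-rowSum : ∀ {n} (f : BoolFun n) x → Σcube n (adj f x) ≡ ℕ→ℚ (sensitivity f x)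
  adj-rowSum f []            = ℚ.+-identityʳ _
  adj-rowSum {suc n} f (b ∷ x) = begin
      Σcube (suc n) (adj f (b ∷ x))
    ≡⟨ Σcube-split b (adj f (b ∷ x)) ⟩
      Σcube n (λ y → adj f (b ∷ x) (b ∷ y)) + Σcube n (λ y → adj f (b ∷ x) (not b ∷ y))
    ≡⟨ cong₂ _+_ (∑-cong (cube n) (adj-∷-same f b x)) (∑-cong (cube n) (adj-∷-not f b x)) ⟩
      Σcube n (adj fᵇ x) + Σcube n (λ y → 𝟙 (isOne (suc (hamming x y)) ∧ (f (b ∷ x) xor f (not b ∷ y))))
    ≡⟨ cong₂ _+_ (adj-rowSum fᵇ x) (Σcube-𝟙-hamming≡0 x (λ y → f (b ∷ x) xor f (not b ∷ y))) ⟩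
      ℕ→ℚ (sensitivity fᵇ x) + 𝟙 (f (b ∷ x) xor f (not b ∷ x))
    ≡⟨ ℚ.+-comm (ℕ→ℚ (sensitivity fᵇ x)) _ ⟩
      𝟙 (f (b ∷ x) xor f (not b ∷ x)) + ℕ→ℚ (sensitivity fᵇ x)
    ≡⟨ ℕ→ℚ-bit-+ (f (b ∷ x) xor f (not b ∷ x)) _ ⟨
      ℕ→ℚ (sensitivity f (b ∷ x)) ∎
    where
    open ≡-Reasoning
    fᵇ : BoolFun n
    fᵇ y = f (b ∷ y)

  𝟙-commute : ∀ e p q → (e ≡ true → p ≡ q) → 𝟙 e * 𝟙 q ≡ 𝟙 p * 𝟙 e
  𝟙-commute false p q _ = trans (ℚ.*-zeroˡ (𝟙 q)) (sym (ℚ.*-zeroʳ (𝟙 p)))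
  𝟙-commute true  p q p≡q rewrite p≡q refl = trans (ℚ.*-identityˡ (𝟙 q)) (sym (ℚ.*-identityʳ (𝟙 q)))

  adj-commute-𝟙 : ∀ {n} {f : BoolFun n} {P : Vec Bool n → Bool} → Closed f P →
                  ∀ x y → adj f x y * 𝟙 (P y) ≡ 𝟙 (P x) * adj f x y
  adj-commute-𝟙 {f = f} {P} P-closed x y = 𝟙-commute (isOne (hamming x y) ∧ (f x xor f y)) (P x) (P y) edge
    where
    edge : isOne (hamming x y) ∧ (f x xor f y) ≡ true → P x ≡ P y
    edge e = P-closed (hamming≡1⇒Flip (isOne⇒≡1 (∧-conicalˡ _ _ e))) (xor≡true⇒≢ (∧-conicalʳ _ _ e))

  module _ {n : ℕ} (M : Vec Bool n → Vec Bool n → ℚ) where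

    schur-test : (∀ x y → M x y ≡ M y x) → (∀ x y → 0ℚ ≤ M x y) →
                 ∀ D → 0ℚ ≤ D → (∀ x → Σcube n (M x) ≤ D) →
                 ∀ v → ‖ M ·ᵥ v ‖² ≤ (D * D) * ‖ v ‖²
    schur-test M-sym M-nonNeg D 0≤D rowSum≤D v = begin
        Σcube n (λ x → (M ·ᵥ v) x * (M ·ᵥ v) x)
      ≤⟨ ∑-mono-≤ (cube n) (λ x → ∑-cauchy-schwarz (cube n) (M x) v (M-nonNeg x)) ⟩
        Σcube n (λ x → Σcube n (M x) * R x)
      ≤⟨ ∑-mono-≤ (cube n) (λ x → ℚ.*-monoʳ-≤-nonNeg (R x) {{nonNegative (R-nonNeg x)}} (rowSum≤D x)) ⟩
        Σcube n (λ x → D * R x)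
      ≡⟨ ∑-*ˡ (cube n) D R ⟩
        D * Σcube n R
      ≡⟨ cong (D *_) ∑R-swap ⟩
        D * Σcube n (λ y → Σcube n (M y) * v² y)
      ≤⟨ ℚ.*-monoˡ-≤-nonNeg D {{nonNegative 0≤D}} (∑-mono-≤ (cube n) (λ y →
           ℚ.*-monoʳ-≤-nonNeg (v² y) {{nonNegative (square-nonNeg (v y))}} (rowSum≤D y))) ⟩
        D * Σcube n (λ y → D * v² y)
      ≡⟨ cong (D *_) (∑-*ˡ (cube n) D v²) ⟩
        D * (D * ‖ v ‖²)
      ≡⟨ ℚ.*-assoc D D ‖ v ‖² ⟨
        (D * D) * ‖ v ‖² ∎
      where
      open ℚ.≤-Reasoning
      v² : Vec Bool n → ℚ
      v² y = v y * v y
      R : Vec Bool n → ℚ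
      R x = Σcube n (λ y → M x y * v² y)
      R-nonNeg : ∀ x → 0ℚ ≤ R x
      R-nonNeg x = ∑-nonNeg (cube n) (λ y → *-nonNeg (M-nonNeg x y) (square-nonNeg (v y)))
      ∑R-swap : Σcube n R ≡ Σcube n (λ y → Σcube n (M y) * v² y)
      ∑R-swap = trans (∑-swap (cube n) (cube n) (λ x y → M x y * v² y))
        (∑-cong (cube n) (λ y → trans (∑-*ʳ (cube n) (v² y) (λ x → M x y))
          (cong (_* v² y) (∑-cong (cube n) (λ x → M-sym x y)))))

    indicator-eigenvector : (P : Vec Bool n → Bool) → (∀ x y → M x y * 𝟙 (P y) ≡ 𝟙 (P x) * M x y) →
                            ∀ D → (∀ x → P x ≡ true → Σcube n (M x) ≡ D) →
                            ∀ x → (M ·ᵥ (λ y → 𝟙 (P y))) x ≡ D * 𝟙 (P x)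
    indicator-eigenvector P M-commute D rowSum≡D x =
      trans (∑-cong (cube n) (M-commute x))
        (trans (∑-*ˡ (cube n) (𝟙 (P x)) (M x)) (scale (P x) refl))
      where
      scale : ∀ b → P x ≡ b → 𝟙 b * Σcube n (M x) ≡ D * 𝟙 b
      scale true  Px = trans (ℚ.*-identityˡ (Σcube n (M x))) (trans (rowSum≡D x Px) (sym (ℚ.*-identityʳ D)))
      scale false _  = trans (ℚ.*-zeroˡ (Σcube n (M x))) (sym (ℚ.*-zeroʳ D))

  ‖‖²-scale : ∀ {n} (c : ℚ) {v w : RVec n} → (∀ x → w x ≡ c * v x) → ‖ w ‖² ≡ (c * c) * ‖ v ‖²
  ‖‖²-scale {n} c {v} w≡cv =
    trans (∑-cong (cube n) (λ x → trans (cong₂ _*_ (w≡cv x) (w≡cv x)) (square-* c (v x))))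
          (∑-*ˡ (cube n) (c * c) (λ x → v x * v x))
    where
    open +-*-Solver
    square-* : ∀ c p → (c * p) * (c * p) ≡ (c * c) * (p * p)
    square-* = solve 2 (λ c p → (c :* p) :* (c :* p) := (c :* c) :* (p :* p)) refl

  ‖𝟙‖²≢0 : ∀ {n} (P : Vec Bool n → Bool) {x₀} → P x₀ ≡ true → ‖ (λ x → 𝟙 (P x)) ‖² ≢ 0ℚ
  ‖𝟙‖²≢0 {n} P {x₀} Px₀ ‖𝟙‖²≡0 = ℚ.<-irrefl refl (ℚ.<-≤-trans (ℚ.positive⁻¹ 1ℚ) (begin
      1ℚ                    ≡⟨ cong (λ b → 𝟙 b * 𝟙 b) Px₀ ⟨
      𝟙 (P x₀) * 𝟙 (P x₀)   ≤⟨ ∑-≥-term (λ x → square-nonNeg (𝟙 (P x))) (∈-cube x₀) ⟩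
      ‖ (λ x → 𝟙 (P x)) ‖²  ≡⟨ ‖𝟙‖²≡0 ⟩
      0ℚ                    ∎))
    where open ℚ.≤-Reasoning

  spectralSensitivityIs-regular : ∀ {n} (f : BoolFun n) (D : ℕ) (P : Vec Bool n → Bool) {x₀} → P x₀ ≡ true →
    Closed f P → (∀ x → sensitivity f x ℕ.≤ D) → (∀ x → P x ≡ true → sensitivity f x ≡ D) →
    spectralSensitivityIs f (ℕ→ℚ D)
  spectralSensitivityIs-regular f D P Px₀ P-closed sens≤D sens≡D =
      schur-test (adj f) (adj-sym f) (adj-nonNeg f) (ℕ→ℚ D) (ℕ→ℚ-nonNeg D)
        (λ x → subst (_≤ ℕ→ℚ D) (sym (adj-rowSum f x)) (ℕ→ℚ-mono-≤ (sens≤D x)))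
    , (λ x → 𝟙 (P x))
    , ‖𝟙‖²≢0 P Px₀
    , ‖‖²-scale (ℕ→ℚ D) (indicator-eigenvector (adj f) P (adj-commute-𝟙 P-closed) (ℕ→ℚ D)
        (λ x Px → trans (adj-rowSum f x) (cong ℕ→ℚ (sens≡D x Px))))

open SpectralNorm using (spectralSensitivityIs-regular)
open import Data.Nat using (_≤_; _+_; _*_)

chunks-++ : ∀ {A : Set} a {b} (u : Vec A b) (w : Vec A (a * b)) → chunks (suc a) b (u ++ w) ≡ u ∷ chunks a b w
chunks-++ a {b} u w =
  cong₂ (λ u′ w′ → u′ ∷ chunks a b w′) (Vec.++-injectiveˡ _ u split) (Vec.++-injectiveʳ _ u split)
  where split = Vec.take++drop≡id b (u ++ w)

chunks-concat : ∀ {A : Set} a {b} (us : Vec (Vec A b) a) → chunks a b (concat us) ≡ us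
chunks-concat zero    []       = refl
chunks-concat (suc a) (u ∷ us) = trans (chunks-++ a u (concat us)) (cong (u ∷_) (chunks-concat a us))

⊚-++ : ∀ {a b} (F : BoolFun (suc a)) (G : BoolFun b) u w → (F ⊚ G) (u ++ w) ≡ F (G u ∷ map G (chunks a b w))
⊚-++ {a} F G u w = cong (F ∘ map G) (chunks-++ a u w)

sensitivity-cong : ∀ {n} {f g : BoolFun n} → (∀ y → f y ≡ g y) → ∀ x → sensitivity f x ≡ sensitivity g x
sensitivity-cong f≡g []      = refl
sensitivity-cong f≡g (b ∷ x) =
  cong₂ _+_ (cong₂ (λ p q → bit (p xor q)) (f≡g _) (f≡g _)) (sensitivity-cong (λ y → f≡g (b ∷ y)) x)

sensitivity-++ : ∀ {m k} (f : BoolFun (m + k)) (u : Vec Bool m) (w : Vec Bool k) →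
  sensitivity f (u ++ w) ≡ sensitivity (λ u′ → f (u′ ++ w)) u + sensitivity (λ w′ → f (u ++ w′)) w
sensitivity-++ f []      w = refl
sensitivity-++ f (b ∷ u) w =
  trans (cong (bit e +_) (sensitivity-++ (λ y → f (b ∷ y)) u w)) (sym (ℕ.+-assoc (bit e) _ _))
  where e = f (b ∷ u ++ w) xor f (not b ∷ u ++ w)

bit-xor-∘ : ∀ (H : Bool → Bool) c g₁ g₂ → bit (H g₁ xor H g₂) ≡ bit (H c xor H (not c)) * bit (g₁ xor g₂)
bit-xor-∘ H c     true  true  rewrite xor-same (H true)  = sym (ℕ.*-zeroʳ (bit (H c xor H (not c))))
bit-xor-∘ H c     false false rewrite xor-same (H false) = sym (ℕ.*-zeroʳ (bit (H c xor H (not c))))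
bit-xor-∘ H true  true  false = sym (ℕ.*-identityʳ _)
bit-xor-∘ H false true  false = trans (cong bit (xor-comm (H true) (H false))) (sym (ℕ.*-identityʳ _))
bit-xor-∘ H false false true  = sym (ℕ.*-identityʳ _)
bit-xor-∘ H true  false true  = trans (cong bit (xor-comm (H false) (H true))) (sym (ℕ.*-identityʳ _))

sensitivity-∘ : ∀ {m} (H : Bool → Bool) (G : BoolFun m) c u →
                sensitivity (H ∘ G) u ≡ bit (H c xor H (not c)) * sensitivity G u
sensitivity-∘ H G c []      = sym (ℕ.*-zeroʳ (bit (H c xor H (not c))))
sensitivity-∘ H G c (b ∷ u) =
  trans (cong₂ _+_ (bit-xor-∘ H c (G (b ∷ u)) (G (not b ∷ u))) (sensitivity-∘ H (λ y → G (b ∷ y)) c u))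
        (sym (ℕ.*-distribˡ-+ (bit (H c xor H (not c))) _ _))

weightedSensitivity : ∀ {a} → BoolFun a → Vec Bool a → Vec ℕ a → ℕ
weightedSensitivity F []      []       = 0
weightedSensitivity F (c ∷ z) (m ∷ ms) =
  bit (F (c ∷ z) xor F (not c ∷ z)) * m + weightedSensitivity (λ z′ → F (c ∷ z′)) z ms

sensitivity-⊚ : ∀ a {b} (F : BoolFun a) (G : BoolFun b) x →
  sensitivity (F ⊚ G) x ≡ weightedSensitivity F (map G (chunks a b x)) (map (sensitivity G) (chunks a b x))
sensitivity-⊚ zero    F G [] = refl
sensitivity-⊚ (suc a) {b} F G x with splitAt b x
-- Abstracting over splitAt b x also turns chunks (suc a) b x into u ∷ chunks a b w.
... | u , w , refl = begin
    sensitivity (F ⊚ G) (u ++ w)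
  ≡⟨ sensitivity-++ (F ⊚ G) u w ⟩
    sensitivity (λ u′ → (F ⊚ G) (u′ ++ w)) u + sensitivity (λ w′ → (F ⊚ G) (u ++ w′)) w
  ≡⟨ cong₂ _+_ (sensitivity-cong (λ u′ → ⊚-++ F G u′ w) u) (sensitivity-cong (λ w′ → ⊚-++ F G u w′) w) ⟩
    sensitivity (λ u′ → F (G u′ ∷ zs)) u + sensitivity (Fᵘ ⊚ G) w
  ≡⟨ cong₂ _+_ (sensitivity-∘ (λ c → F (c ∷ zs)) G (G u) u) (sensitivity-⊚ a Fᵘ G w) ⟩
    weightedSensitivity F (map G (u ∷ chunks a b w)) (map (sensitivity G) (u ∷ chunks a b w)) ∎
  where
  open ≡-Reasoning
  zs = map G (chunks a b w)
  Fᵘ : BoolFun a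
  Fᵘ z = F (G u ∷ z)

all : ∀ {A : Set} {n} → (A → Bool) → Vec A n → Bool
all P []       = true
all P (u ∷ us) = P u ∧ all P us

module _ {b M : ℕ} {h : Vec Bool b → ℕ} where

  weightedSensitivity-≤ : (∀ u → h u ≤ M) →
    ∀ {a} (F : BoolFun a) z us → weightedSensitivity F z (map h us) ≤ sensitivity F z * M
  weightedSensitivity-≤ h≤M F []      []       = z≤n
  weightedSensitivity-≤ h≤M F (c ∷ z) (u ∷ us) = ℕ.≤-trans
    (ℕ.+-mono-≤ (ℕ.*-monoʳ-≤ (bit e) (h≤M u)) (weightedSensitivity-≤ h≤M (λ z′ → F (c ∷ z′)) z us))
    (ℕ.≤-reflexive (sym (ℕ.*-distribʳ-+ M (bit e) _)))
    where e = F (c ∷ z) xor F (not c ∷ z)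

  weightedSensitivity-≡ : ∀ {P : Vec Bool b → Bool} → (∀ u → P u ≡ true → h u ≡ M) →
    ∀ {a} (F : BoolFun a) z us → all P us ≡ true → weightedSensitivity F z (map h us) ≡ sensitivity F z * M
  weightedSensitivity-≡ h≡M F []      []       _   = refl
  weightedSensitivity-≡ h≡M F (c ∷ z) (u ∷ us) Pus = trans
    (cong₂ (λ m r → bit e * m + r) (h≡M u (∧-conicalˡ _ _ Pus))
      (weightedSensitivity-≡ h≡M (λ z′ → F (c ∷ z′)) z us (∧-conicalʳ _ _ Pus)))
    (sym (ℕ.*-distribʳ-+ M (bit e) _))
    where e = F (c ∷ z) xor F (not c ∷ z)

blockwise : ∀ {a b} → BoolFun b → (Vec Bool a → Bool) → (Vec Bool b → Bool) → Vec Bool (a * b) → Bool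
blockwise {a} {b} G Q P x = all P (chunks a b x) ∧ Q (map G (chunks a b x))

module _ {a b} (F : BoolFun a) (G : BoolFun b) where

  sensitivity-⊚-≤ : ∀ {K M} → (∀ z → sensitivity F z ≤ K) → (∀ u → sensitivity G u ≤ M) →
                    ∀ x → sensitivity (F ⊚ G) x ≤ K * M
  sensitivity-⊚-≤ {K} {M} sF≤K sG≤M x = begin
    sensitivity (F ⊚ G) x                              ≡⟨ sensitivity-⊚ a F G x ⟩
    weightedSensitivity F zs (map (sensitivity G) us)  ≤⟨ weightedSensitivity-≤ sG≤M F zs us ⟩
    sensitivity F zs * M                               ≤⟨ ℕ.*-monoˡ-≤ M (sF≤K zs) ⟩
    K * M                                              ∎
    where
    open ℕ.≤-Reasoning
    us = chunks a b x
    zs = map G us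

  sensitivity-⊚-≡ : ∀ {K M Q P} → (∀ z → Q z ≡ true → sensitivity F z ≡ K) →
                    (∀ u → P u ≡ true → sensitivity G u ≡ M) →
                    ∀ x → blockwise G Q P x ≡ true → sensitivity (F ⊚ G) x ≡ K * M
  sensitivity-⊚-≡ {K} {M} {Q} {P} sF≡K sG≡M x QPx = trans (sensitivity-⊚ a F G x)
    (trans (weightedSensitivity-≡ sG≡M F zs (chunks a b x) (∧-conicalˡ _ (Q zs) QPx))
           (cong (_* M) (sF≡K zs (∧-conicalʳ (all P (chunks a b x)) _ QPx))))
    where zs = map G (chunks a b x)

Flip-++ : ∀ {m k} (u : Vec Bool m) (w : Vec Bool k) {y} → Flip (u ++ w) y →
          (∃ λ u′ → Flip u u′ × y ≡ u′ ++ w) ⊎ (∃ λ w′ → Flip w w′ × y ≡ u ++ w′)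
Flip-++ []      w uw~y         = inj₂ (_ , uw~y , refl)
Flip-++ (b ∷ u) w here         = inj₁ (not b ∷ u , here , refl)
Flip-++ (b ∷ u) w (there uw~y) with Flip-++ u w uw~y
... | inj₁ (u′ , u~u′ , refl) = inj₁ (b ∷ u′ , there u~u′ , refl)
... | inj₂ (w′ , w~w′ , refl) = inj₂ (w′ , w~w′ , refl)

blockwise-++ : ∀ {a b} (G : BoolFun b) (Q : Vec Bool (suc a) → Bool) (P : Vec Bool b → Bool) u w →
  blockwise G Q P (u ++ w) ≡ (P u ∧ all P (chunks a b w)) ∧ Q (G u ∷ map G (chunks a b w))
blockwise-++ {a} G Q P u w = cong (λ us → all P us ∧ Q (map G us)) (chunks-++ a u w)

-- A sensitive flip of F ⊚ G either flips a sensitive bit of one block, changing the value of G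
-- there and hence flipping a sensitive input of F, or it happens inside the remaining blocks.
Closed-⊚ : ∀ a {b} {F : BoolFun a} {G : BoolFun b} {Q P} →
           Closed F Q → Closed G P → Closed (F ⊚ G) (blockwise G Q P)
Closed-⊚ zero F-closed G-closed () _
Closed-⊚ (suc a) {b} {F} {G} {Q} {P} F-closed G-closed {x} x~y Fx≢Fy with splitAt b x
... | u , w , refl with Flip-++ u w x~y
...   | inj₁ (u′ , u~u′ , refl) =
  trans (cong₂ (λ p q → (p ∧ all P (chunks a b w)) ∧ q)
               (G-closed u~u′ Gu≢Gu′) (F-closed Gu~Gu′ F′Gu≢F′Gu′))
        (sym (blockwise-++ G Q P u′ w))
  where
  zs = map G (chunks a b w)
  F′ : Bool → Bool
  F′ c = F (c ∷ zs)
  F′Gu≢F′Gu′ : F′ (G u) ≢ F′ (G u′)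
  F′Gu≢F′Gu′ e = Fx≢Fy (trans e (sym (⊚-++ F G u′ w)))
  Gu≢Gu′ : G u ≢ G u′
  Gu≢Gu′ = F′Gu≢F′Gu′ ∘ cong F′
  Gu~Gu′ : Flip (G u ∷ zs) (G u′ ∷ zs)
  Gu~Gu′ = subst (λ c → Flip (G u ∷ zs) (c ∷ zs)) (sym (¬-not (Gu≢Gu′ ∘ sym))) here
...   | inj₂ (w′ , w~w′ , refl) = begin
    (P u ∧ all P (chunks a b w)) ∧ Q (G u ∷ map G (chunks a b w))
  ≡⟨ ∧-assoc (P u) _ _ ⟩
    P u ∧ blockwise G Qᵘ P w
  ≡⟨ cong (P u ∧_) (Closed-⊚ a {F = Fᵘ} {Q = Qᵘ} (F-closed ∘ there) G-closed w~w′ Fᵘw≢Fᵘw′) ⟩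
    P u ∧ blockwise G Qᵘ P w′
  ≡⟨ ∧-assoc (P u) _ _ ⟨
    (P u ∧ all P (chunks a b w′)) ∧ Q (G u ∷ map G (chunks a b w′))
  ≡⟨ blockwise-++ G Q P u w′ ⟨
    blockwise G Q P (u ++ w′) ∎
  where
  open ≡-Reasoning
  Fᵘ : BoolFun a
  Fᵘ z = F (G u ∷ z)
  Qᵘ : Vec Bool a → Bool
  Qᵘ z = Q (G u ∷ z)
  Fᵘw≢Fᵘw′ : (Fᵘ ⊚ G) w ≢ (Fᵘ ⊚ G) w′
  Fᵘw≢Fᵘw′ e = Fx≢Fy (trans e (sym (⊚-++ F G u w′)))

module _ {a b : ℕ} (G : BoolFun b) (w : Bool → Vec Bool b) (G∘w : ∀ c → G (w c) ≡ c) where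

  map-section : ∀ {k} (z : Vec Bool k) → map G (map w z) ≡ z
  map-section []      = refl
  map-section (c ∷ z) = cong₂ _∷_ (G∘w c) (map-section z)

  ⊚-concat-section : ∀ (F : BoolFun a) z → (F ⊚ G) (concat (map w z)) ≡ F z
  ⊚-concat-section F z = trans (cong (F ∘ map G) (chunks-concat a (map w z))) (cong F (map-section z))

  blockwise-concat-section : ∀ (Q : Vec Bool a → Bool) (P : Vec Bool b → Bool) → (∀ c → P (w c) ≡ true) →
                             ∀ z → blockwise G Q P (concat (map w z)) ≡ Q z
  blockwise-concat-section Q P P∘w z =
    trans (cong (λ us → all P us ∧ Q (map G us)) (chunks-concat a (map w z)))
          (cong₂ _∧_ (all-section z) (cong Q (map-section z)))
    where
    all-section : ∀ {k} (z : Vec Bool k) → all P (map w z) ≡ true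
    all-section []      = refl
    all-section (c ∷ z) = cong₂ _∧_ (P∘w c) (all-section z)

decide-on-cube : ∀ {n} {P : Vec Bool n → Set} (P? : ∀ x → Dec (P x)) →
                 True (All.all? P? (cube n)) → ∀ x → P x
decide-on-cube P? holds = cube-exhaustive (toWitness holds)

tight : Vec Bool 4 → Bool
tight (x₁ ∷ x₂ ∷ x₃ ∷ x₄ ∷ []) = not (x₁ ∧ x₂) ∧ not (x₃ ∧ x₄) ∧ (x₁ ∨ x₂ ∨ x₃ ∨ x₄)

sensitivity-AND∘OR-≤2 : ∀ z → sensitivity AND2∘OR2 z ≤ 2
sensitivity-AND∘OR-≤2 = decide-on-cube (λ z → sensitivity AND2∘OR2 z ℕ.≤? 2) _

sensitivity-AND∘OR-tight : ∀ z → tight z ≡ true → sensitivity AND2∘OR2 z ≡ 2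
sensitivity-AND∘OR-tight = decide-on-cube (λ z → (tight z Bool.≟ true) →-dec (sensitivity AND2∘OR2 z ℕ.≟ 2)) _

Closed-AND∘OR-tight : Closed AND2∘OR2 tight
Closed-AND∘OR-tight {x} {y} x~y = cube-exhaustive (sensitiveEdges x) y (Flip⇒hamming≡1 x~y)
  where
  sensitiveEdges : ∀ x → All (λ y → hamming x y ≡ 1 → AND2∘OR2 x ≢ AND2∘OR2 y → tight x ≡ tight y) (cube 4)
  sensitiveEdges = decide-on-cube (λ x → All.all? (λ y →
    (hamming x y ℕ.≟ 1) →-dec ¬? (AND2∘OR2 x Bool.≟ AND2∘OR2 y) →-dec (tight x Bool.≟ tight y)) (cube 4)) _

Tight : ∀ d → Vec Bool (4 ^ d) → Bool
Tight zero    _ = true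
Tight (suc d) = blockwise (AND2∘OR2 ^^ d) tight (Tight d)

Closed-Tight : ∀ d → Closed (AND2∘OR2 ^^ d) (Tight d)
Closed-Tight zero    _ _ = refl
Closed-Tight (suc d) = Closed-⊚ 4 Closed-AND∘OR-tight (Closed-Tight d)

sensitivity-^^-≤ : ∀ d x → sensitivity (AND2∘OR2 ^^ d) x ≤ 2 ^ d
sensitivity-^^-≤ zero    (false ∷ []) = ℕ.≤-refl
sensitivity-^^-≤ zero    (true ∷ [])  = ℕ.≤-refl
sensitivity-^^-≤ (suc d) = sensitivity-⊚-≤ AND2∘OR2 (AND2∘OR2 ^^ d) sensitivity-AND∘OR-≤2 (sensitivity-^^-≤ d)

sensitivity-Tight : ∀ d x → Tight d x ≡ true → sensitivity (AND2∘OR2 ^^ d) x ≡ 2 ^ d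
sensitivity-Tight zero    (false ∷ []) _ = refl
sensitivity-Tight zero    (true ∷ [])  _ = refl
sensitivity-Tight (suc d) = sensitivity-⊚-≡ AND2∘OR2 (AND2∘OR2 ^^ d) sensitivity-AND∘OR-tight (sensitivity-Tight d)

tightPoint : Bool → Vec Bool 4
tightPoint true  = true  ∷ false ∷ true ∷ false ∷ []
tightPoint false = false ∷ false ∷ true ∷ false ∷ []

tightPoint-tight : ∀ c → tight (tightPoint c) ≡ true
tightPoint-tight true  = refl
tightPoint-tight false = refl

AND∘OR-tightPoint : ∀ c → AND2∘OR2 (tightPoint c) ≡ c
AND∘OR-tightPoint true  = refl
AND∘OR-tightPoint false = refl

Tight-witness : ∀ d c → Σ (Vec Bool (4 ^ d)) λ x → Tight d x ≡ true × (AND2∘OR2 ^^ d) x ≡ c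
Tight-witness zero    c = c ∷ [] , refl , refl
Tight-witness (suc d) c =
    concat (map w (tightPoint c))
  , trans (blockwise-concat-section G w G∘w tight (Tight d) (proj₁ ∘ proj₂ ∘ Tight-witness d) (tightPoint c))
          (tightPoint-tight c)
  , trans (⊚-concat-section G w G∘w AND2∘OR2 (tightPoint c)) (AND∘OR-tightPoint c)
  where
  G : BoolFun (4 ^ d)
  G = AND2∘OR2 ^^ d
  w : Bool → Vec Bool (4 ^ d)
  w c = proj₁ (Tight-witness d c)
  G∘w : ∀ c → G (w c) ≡ c
  G∘w c = proj₂ (proj₂ (Tight-witness d c))

lemma30 : (d : ℕ) → 1 ≤ d →
    spectralSensitivityIs (AND2∘OR2 ^^ d) (ℕ→ℚ (2 ^ d))
lemma30 d _ = spectralSensitivityIs-regular (AND2∘OR2 ^^ d) (2 ^ d) (Tight d)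
  (proj₁ (proj₂ (Tight-witness d true))) (Closed-Tight d) (sensitivity-^^-≤ d) (sensitivity-Tight d)
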